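{- Let $\alpha,\beta,\gamma$ be shapes with $m$ parts such that $\beta/\alpha$ and $\gamma/\alpha$ are horizontal strips, and define $\delta=\mathcal{C}(\alpha;\beta,\gamma)$ by $d_m:=0$ and, for $i=m,m-1,\dots,2$, $\delta_i:=\min\{\beta_i+\gamma_i+d_i-\alpha_i,\ \alpha_{i-1}\}$, $d_{i-1}:=\max\{\beta_i+\gamma_i+d_i-\alpha_i-\alpha_{i-1},\ 0\}$, and $\delta_1:=\beta_1+\gamma_1+d_1-\alpha_1$. Then $\delta$ is a shape such that $\begin{smallmatrix}\alpha&\beta\\\gamma&\delta\end{smallmatrix}$ is a growth diagram, and the rule is reversible: given shapes $\beta,\gamma,\delta$ with $m$ parts such that $\delta/\beta$ and $\delta/\gamma$ are horizontal strips, there is a unique shape $\alpha$ with $\mathcal{C}(\alpha;\beta,\gamma)=\delta$.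
   Context: A shape is a finite weakly decreasing sequence of integers (positive, zero or negative) $\alpha_1\geq\cdots\geq\alpha_m$; shapes of length $m$ are ordered componentwise by $\subseteq$, and for $\alpha\subseteq\beta$ the skew shape $\beta/\alpha$ consists of the boxes $(i,j)$ with $\alpha_i<j\leq\beta_i$. $\beta/\alpha$ is a horizontal strip if it has at most one box in each column, i.e. $\beta_i\geq\alpha_i\geq\beta_{i+1}$. A tableau is a chain of shapes with horizontal-strip differences; its content is the sequence of sizes of the strips. A growth diagram is a rectangular array of shapes whose rows (left to right) and columns (top to bottom) are tableaux, all rows of the same content and all columns of the same content. -}

module Defs where

open import Data.Nat using (ℕ; zero; suc)
open import Data.Integer using (ℤ; _+_; _-_; _≤_; _⊓_; _⊔_; 0ℤ)
open import Data.Fin using (Fin; toℕ)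
open import Data.Vec using (Vec; []; _∷_; lookup; foldr)
open import Data.Product using (_×_; _,_)
open import Relation.Binary.PropositionalEquality using (_≡_)

-- A shape with m parts: a weakly decreasing vector of integers (index 0 = row 1).
IsShape : ∀ {m} → Vec ℤ m → Set
IsShape {m} v = ∀ (i j : Fin m) → toℕ i Data.Nat.≤ toℕ j → lookup v j ≤ lookup v i

_⊆_ : ∀ {m} → Vec ℤ m → Vec ℤ m → Set
_⊆_ {m} α β = ∀ (i : Fin m) → lookup α i ≤ lookup β i

HorizontalStrip : ∀ {m} → Vec ℤ m → Vec ℤ m → Set
HorizontalStrip {m} β α =
  (α ⊆ β) × (∀ (i j : Fin m) → toℕ j ≡ suc (toℕ i) → lookup β j ≤ lookup α i)

sumℤ : ∀ {m} → Vec ℤ m → ℤ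
sumℤ = foldr _ _+_ 0ℤ

size : ∀ {m} → Vec ℤ m → Vec ℤ m → ℤ
size β α = sumℤ β - sumℤ α

GrowthDiagram : ∀ {m} → (α β γ δ : Vec ℤ m) → Set
GrowthDiagram α β γ δ =
  IsShape α × IsShape β × IsShape γ × IsShape δ ×
  HorizontalStrip β α × HorizontalStrip δ γ ×
  HorizontalStrip γ α × HorizontalStrip δ β ×
  size β α ≡ size δ γ × size γ α ≡ size δ β

-- Auxiliary recursion: given a = α_{i-1} and rows i..m of α, β, γ,
-- return (δ_i, …, δ_m) and the carry d_{i-1}.  (d_m = 0.)
C-aux : ∀ {n} → ℤ → Vec ℤ (suc n) → Vec ℤ (suc n) → Vec ℤ (suc n) → Vec ℤ (suc n) × ℤ
C-aux {zero} a (x ∷ []) (b ∷ []) (g ∷ []) =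
  let s = b + g - x in (s ⊓ a) ∷ [] , ((s - a) ⊔ 0ℤ)
C-aux {suc n} a (x ∷ xs) (b ∷ bs) (g ∷ gs) with C-aux x xs bs gs
... | δs , d = let s = b + g + d - x in (s ⊓ a) ∷ δs , ((s - a) ⊔ 0ℤ)

𝒞 : ∀ {n} → Vec ℤ (suc n) → Vec ℤ (suc n) → Vec ℤ (suc n) → Vec ℤ (suc n)
𝒞 {zero} (x ∷ []) (b ∷ []) (g ∷ []) = (b + g - x) ∷ []
𝒞 {suc n} (x ∷ xs) (b ∷ bs) (g ∷ gs) with C-aux x xs bs gs
... | δs , d = (b + g + d - x) ∷ δs

{-# OPTIONS --safe #-}

-- Row i of 𝒞 forms sᵢ = βᵢ + γᵢ + dᵢ − αᵢ, keeps δᵢ = min(sᵢ, αᵢ₋₁) and passes the overflow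
-- dᵢ₋₁ = max(sᵢ − αᵢ₋₁, 0) up to row i − 1. Since min(s, a) + max(s − a, 0) = s no box is
-- lost, which gives both content equalities. The strips are preserved because
-- βᵢ ≤ sᵢ (as αᵢ ≤ γᵢ and dᵢ ≥ 0) and βᵢ ≤ αᵢ₋₁ ≤ βᵢ₋₁, so capping at αᵢ₋₁ keeps δᵢ
-- between βᵢ and βᵢ₋₁.
--
-- Conversely, the capped value and the overflow determine sᵢ = δᵢ + dᵢ₋₁, hence
-- αᵢ − dᵢ = βᵢ + γᵢ − sᵢ, and αᵢ = max(αᵢ − dᵢ, δᵢ₊₁). Read from the top row down this is an
-- explicit map 𝒞⁻¹ which is a two-sided inverse of 𝒞(−; β, γ) on all integer vectors, so
-- uniqueness is injectivity; if δ/β and δ/γ are strips then so are β/α and γ/α for α = 𝒞⁻¹ β γ δ.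
-- Both maps are symmetric in β and γ, so each strip property is proved for one side only.
module Submission where

open import Defs
open import Data.Nat using (ℕ; suc; zero; z≤n; s≤s)
open import Data.Nat.Properties using (suc-injective)
open import Data.Integer using (ℤ; nonNegative; _+_; _-_; -_; _≤_; _≥_; _⊓_; _⊔_; 0ℤ)
open import Data.Integer.Properties
  using ( ≤-refl; ≤-trans; ≤-total; +-comm; +-identityʳ; +-mono-≤; i≤i+j; +-monoʳ-≤; +-monoˡ-≤; +-monoˡ-<; +-monoʳ-<
        ; module ≤-Reasoning; i≤j⇒i⊓j≡i; i≥j⇒i⊓j≡j; i≤j⇒i⊔j≡j; i≥j⇒i⊔j≡i
        ; i≤j⇒i-j≤0; i≤j⇒0≤j-i; ⊓-glb; ⊔-lub; i≤i⊔j; i≤j⊔i; i⊓j≤j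
        ; mono-<-distrib-⊓; mono-<-distrib-⊔ )
open import Data.Integer.Tactic.RingSolver using (solve; solve-∀)
open import Data.Fin using (Fin; toℕ; zero; suc)
open import Data.List using (List; []; _∷_)
open import Function using (_∋_)
open import Data.Vec using (Vec; []; _∷_; head; lookup)
open import Data.Vec.Relation.Unary.Linked as Linked using (Linked; []; [-]; _∷_)
open import Data.Product using (_×_; _,_; ∃!)
open import Data.Sum using (inj₁; inj₂)
open import Data.Unit using (⊤; tt)
open import Relation.Binary.PropositionalEquality
  using (_≡_; refl; sym; trans; cong; cong₂; subst; module ≡-Reasoning)

private
  variable
    n : ℕ

Head≤ : ℤ → Vec ℤ n → Set
Head≤ a []      = ⊤
Head≤ a (x ∷ _) = x ≤ a

Strip : Vec ℤ n → Vec ℤ n → Set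
Strip []       []       = ⊤
Strip (b ∷ bs) (x ∷ xs) = x ≤ b × Head≤ x bs × Strip bs xs

Head≤-mono : ∀ {a b} {v : Vec ℤ n} → a ≤ b → Head≤ a v → Head≤ b v
Head≤-mono {v = []}    _   _   = tt
Head≤-mono {v = _ ∷ _} a≤b x≤a = ≤-trans x≤a a≤b

HorizontalStrip-tail : ∀ {b x} {bs xs : Vec ℤ n} →
  HorizontalStrip (b ∷ bs) (x ∷ xs) → HorizontalStrip bs xs
HorizontalStrip-tail (α⊆β , interlaced) =
  (λ i → α⊆β (suc i)) , λ i j j≡1+i → interlaced (suc i) (suc j) (cong suc j≡1+i)

HorizontalStrip⇒Strip : {β α : Vec ℤ n} → HorizontalStrip β α → Strip β α
HorizontalStrip⇒Strip {β = []}        {[]}        _ = tt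
HorizontalStrip⇒Strip {β = _ ∷ []}    {_ ∷ []}    (α⊆β , _) = α⊆β zero , tt , tt
HorizontalStrip⇒Strip {β = _ ∷ _ ∷ _} {_ ∷ _ ∷ _} hs@(α⊆β , interlaced) =
  α⊆β zero , interlaced zero (suc zero) refl , HorizontalStrip⇒Strip (HorizontalStrip-tail hs)

Strip⇒⊆ : {β α : Vec ℤ n} → Strip β α → α ⊆ β
Strip⇒⊆ {β = _ ∷ _} {_ ∷ _} (x≤b , _ , _) zero    = x≤b
Strip⇒⊆ {β = _ ∷ _} {_ ∷ _} (_ , _ , s)   (suc i) = Strip⇒⊆ s i

Strip⇒interlaced : {β α : Vec ℤ n} → Strip β α →
  ∀ (i j : Fin n) → toℕ j ≡ suc (toℕ i) → lookup β j ≤ lookup α i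
Strip⇒interlaced {β = _ ∷ _ ∷ _} {_ ∷ _ ∷ _} (_ , b′≤x , _) zero (suc zero) refl = b′≤x
Strip⇒interlaced {β = _ ∷ _} {_ ∷ _} (_ , _ , s) (suc i) (suc j) j≡1+i =
  Strip⇒interlaced s i j (suc-injective j≡1+i)

Strip⇒HorizontalStrip : {β α : Vec ℤ n} → Strip β α → HorizontalStrip β α
Strip⇒HorizontalStrip s = Strip⇒⊆ s , Strip⇒interlaced s

Linked≥⇒IsShape : {v : Vec ℤ n} → Linked _≥_ v → IsShape v
Linked≥⇒IsShape                 _          zero    zero    _         = ≤-refl
Linked≥⇒IsShape {v = _ ∷ _ ∷ _} (x≥y ∷ xs) zero    (suc j) _         =
  ≤-trans (Linked≥⇒IsShape xs zero j z≤n) x≥y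
Linked≥⇒IsShape {v = _ ∷ _}     xs         (suc i) (suc j) (s≤s i≤j) =
  Linked≥⇒IsShape (Linked.tail xs) i j i≤j

Strip⇒Linked-outer : {β α : Vec ℤ n} → Strip β α → Linked _≥_ β
Strip⇒Linked-outer {β = []}        {[]}        _                = []
Strip⇒Linked-outer {β = _ ∷ []}    {_ ∷ []}    _                = [-]
Strip⇒Linked-outer {β = _ ∷ _ ∷ _} {_ ∷ _ ∷ _} (x≤b , b′≤x , s) =
  ≤-trans b′≤x x≤b ∷ Strip⇒Linked-outer s

Strip⇒Linked-inner : {β α : Vec ℤ n} → Strip β α → Linked _≥_ α
Strip⇒Linked-inner {β = []}        {[]}        _ = []
Strip⇒Linked-inner {β = _ ∷ []}    {_ ∷ []}    _ = [-]
Strip⇒Linked-inner {β = _ ∷ _ ∷ _} {_ ∷ _ ∷ _} (_ , b′≤x , s@(x′≤b′ , _)) =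
  ≤-trans x′≤b′ b′≤x ∷ Strip⇒Linked-inner s

Strip⇒IsShape-outer : {β α : Vec ℤ n} → Strip β α → IsShape β
Strip⇒IsShape-outer s = Linked≥⇒IsShape (Strip⇒Linked-outer s)

Strip⇒IsShape-inner : {β α : Vec ℤ n} → Strip β α → IsShape α
Strip⇒IsShape-inner s = Linked≥⇒IsShape (Strip⇒Linked-inner s)

i+[j-i]≡j : ∀ i j → i + (j - i) ≡ j
i+[j-i]≡j = solve-∀

i-j+j≡i : ∀ i j → i - j + j ≡ i
i-j+j≡i = solve-∀

i+j+k≡i+k+j : ∀ i j k → i + j + k ≡ i + k + j
i+j+k≡i+k+j = solve-∀

i+j-[i+j-k]≡k : ∀ i j k → i + j - (i + j - k) ≡ k
i+j-[i+j-k]≡k = solve-∀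

i+j-[i+j+k-l]≡l-k : ∀ i j k l → i + j - (i + j + k - l) ≡ l - k
i+j-[i+j+k-l]≡l-k = solve-∀

i+j+k-[i+j-l+k]≡l : ∀ i j k l → i + j + k - (i + j - l + k) ≡ l
i+j+k-[i+j-l+k]≡l = solve-∀

i⊓j+[i-j]⊔0≡i : ∀ i j → i ⊓ j + ((i - j) ⊔ 0ℤ) ≡ i
i⊓j+[i-j]⊔0≡i i j with ≤-total i j
... | inj₁ i≤j = begin
  i ⊓ j + ((i - j) ⊔ 0ℤ)  ≡⟨ cong₂ _+_ (i≤j⇒i⊓j≡i i≤j) (i≤j⇒i⊔j≡j (i≤j⇒i-j≤0 i≤j)) ⟩
  i + 0ℤ                  ≡⟨ +-identityʳ i ⟩
  i                       ∎
  where open ≡-Reasoning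
... | inj₂ j≤i = begin
  i ⊓ j + ((i - j) ⊔ 0ℤ)  ≡⟨ cong₂ _+_ (i≥j⇒i⊓j≡j j≤i) (i≥j⇒i⊔j≡i (i≤j⇒0≤j-i j≤i)) ⟩
  j + (i - j)             ≡⟨ i+[j-i]≡j j i ⟩
  i                       ∎
  where open ≡-Reasoning

i+[j-i]⊔0≡j⊔i : ∀ i j → i + ((j - i) ⊔ 0ℤ) ≡ j ⊔ i
i+[j-i]⊔0≡j⊔i i j = begin
  i + ((j - i) ⊔ 0ℤ)       ≡⟨ mono-<-distrib-⊔ (i +_) (+-monoʳ-< i) (j - i) 0ℤ ⟩
  (i + (j - i)) ⊔ (i + 0ℤ)  ≡⟨ cong₂ _⊔_ (i+[j-i]≡j i j) (+-identityʳ i) ⟩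
  j ⊔ i                     ∎
  where open ≡-Reasoning

k≤k+j-i : ∀ k {i j} → i ≤ j → k ≤ k + j - i
k≤k+j-i k {i} {j} i≤j = begin
  k          ≡⟨ solve (List ℤ ∋ k ∷ i ∷ []) ⟩
  k + i - i  ≤⟨ +-monoˡ-≤ (- i) (+-monoʳ-≤ k i≤j) ⟩
  k + j - i  ∎
  where open ≤-Reasoning

k≤k+j+l-i : ∀ k {i j l} → i ≤ j → 0ℤ ≤ l → k ≤ k + j + l - i
k≤k+j+l-i k {i} {j} {l} i≤j 0≤l = begin
  k               ≡⟨ solve (List ℤ ∋ k ∷ i ∷ []) ⟩
  k + i + 0ℤ - i  ≤⟨ +-monoˡ-≤ (- i) (+-mono-≤ (+-monoʳ-≤ k i≤j) 0≤l) ⟩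
  k + j + l - i   ∎
  where open ≤-Reasoning

k+i-j≤k : ∀ k {i j} → i ≤ j → k + i - j ≤ k
k+i-j≤k k {i} {j} i≤j = begin
  k + i - j  ≤⟨ +-monoˡ-≤ (- j) (+-monoʳ-≤ k i≤j) ⟩
  k + j - j  ≡⟨ solve (List ℤ ∋ k ∷ j ∷ []) ⟩
  k          ∎
  where open ≤-Reasoning

d+a≡b+c⇒b-a≡d-c : ∀ {a b c d} → d + a ≡ b + c → b - a ≡ d - c
d+a≡b+c⇒b-a≡d-c {a} {b} {c} {d} d+a≡b+c = begin
  b - a          ≡⟨ solve (List ℤ ∋ a ∷ b ∷ c ∷ []) ⟩
  b + c - a - c  ≡⟨ cong (λ s → s - a - c) d+a≡b+c ⟨
  d + a - a - c  ≡⟨ solve (List ℤ ∋ a ∷ c ∷ d ∷ []) ⟩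
  d - c          ∎
  where open ≡-Reasoning

capHead : ℤ → Vec ℤ (suc n) → Vec ℤ (suc n)
capHead a (s ∷ v) = s ⊓ a ∷ v

overflow : ℤ → Vec ℤ (suc n) → ℤ
overflow a v = (head v - a) ⊔ 0ℤ

raiseHead : ℤ → Vec ℤ (suc n) → Vec ℤ (suc n)
raiseHead e (s ∷ v) = s + e ∷ v

0≤overflow : ∀ a (v : Vec ℤ (suc n)) → 0ℤ ≤ overflow a v
0≤overflow a v = i≤j⊔i (head v - a) 0ℤ

raiseHead-overflow-capHead : ∀ a (v : Vec ℤ (suc n)) →
  raiseHead (overflow a v) (capHead a v) ≡ v
raiseHead-overflow-capHead a (s ∷ v) = cong (_∷ v) (i⊓j+[i-j]⊔0≡i s a)

overflow-raiseHead : ∀ a e (v : Vec ℤ (suc n)) → overflow (a + e) (raiseHead e v) ≡ overflow a v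
overflow-raiseHead a e (s ∷ v) = cong (_⊔ 0ℤ) (solve (List ℤ ∋ a ∷ e ∷ s ∷ []))

capHead-raiseHead : ∀ a e (v : Vec ℤ (suc n)) →
  capHead (a + e) (raiseHead e v) ≡ raiseHead e (capHead a v)
capHead-raiseHead a e (s ∷ v) = cong (_∷ v) (sym (mono-<-distrib-⊓ (_+ e) (+-monoˡ-< e) s a))

capHead-raiseHead-overflow : ∀ a (v : Vec ℤ (suc n)) →
  capHead (a + overflow a v) (raiseHead (overflow a v) v) ≡ v
capHead-raiseHead-overflow a v =
  trans (capHead-raiseHead a (overflow a v) v) (raiseHead-overflow-capHead a v)

overflow-capHead : ∀ a (v : Vec ℤ (suc n)) →
  overflow (a - overflow a v) (capHead a v) ≡ overflow a v
overflow-capHead a v = begin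
  overflow (a - o) (capHead a v)
    ≡⟨ overflow-raiseHead (a - o) o (capHead a v) ⟨
  overflow (a - o + o) (raiseHead o (capHead a v))
    ≡⟨ cong₂ overflow (i-j+j≡i a o) (raiseHead-overflow-capHead a v) ⟩
  overflow a v
    ∎
  where
  open ≡-Reasoning
  o = overflow a v

sumℤ-raiseHead : ∀ e (v : Vec ℤ (suc n)) → sumℤ (raiseHead e v) ≡ sumℤ v + e
sumℤ-raiseHead e (s ∷ v) = i+j+k≡i+k+j s e (sumℤ v)

sumℤ-capHead : ∀ a (v : Vec ℤ (suc n)) → sumℤ (capHead a v) + overflow a v ≡ sumℤ v
sumℤ-capHead a v = begin
  sumℤ (capHead a v) + overflow a v              ≡⟨ sumℤ-raiseHead (overflow a v) (capHead a v) ⟨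
  sumℤ (raiseHead (overflow a v) (capHead a v))  ≡⟨ cong sumℤ (raiseHead-overflow-capHead a v) ⟩
  sumℤ v                                         ∎
  where open ≡-Reasoning

Head≤-capHead : ∀ a (v : Vec ℤ (suc n)) → Head≤ a (capHead a v)
Head≤-capHead a (s ∷ _) = i⊓j≤j s a

capHead-strip : ∀ {a} {v w : Vec ℤ (suc n)} → Head≤ a w → Strip v w → Strip (capHead a v) w
capHead-strip {v = _ ∷ _} {_ ∷ _} y≤a (y≤s , rest) = ⊓-glb y≤s y≤a , rest

raiseHead-strip : ∀ {e} {v w : Vec ℤ (suc n)} → 0ℤ ≤ e → Strip v w → Strip (raiseHead e v) w
raiseHead-strip {e = e} {v = s ∷ _} {_ ∷ _} 0≤e (y≤s , rest) =
  ≤-trans y≤s (i≤i+j s e {{nonNegative 0≤e}}) , rest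

C-aux≡capHead-overflow : ∀ a (α β γ : Vec ℤ (suc n)) →
  C-aux a α β γ ≡ (capHead a (𝒞 α β γ) , overflow a (𝒞 α β γ))
C-aux≡capHead-overflow {zero}  a (x ∷ [])  (b ∷ [])  (g ∷ [])  = refl
C-aux≡capHead-overflow {suc n} a (x ∷ xs) (b ∷ bs) (g ∷ gs) with C-aux x xs bs gs
... | _ = refl

𝒞-∷ : ∀ x (xs : Vec ℤ (suc n)) b bs g gs →
  𝒞 (x ∷ xs) (b ∷ bs) (g ∷ gs) ≡ b + g + overflow x (𝒞 xs bs gs) - x ∷ capHead x (𝒞 xs bs gs)
𝒞-∷ x xs b bs g gs rewrite C-aux≡capHead-overflow x xs bs gs = refl

𝒞-comm : ∀ (α β γ : Vec ℤ (suc n)) → 𝒞 α β γ ≡ 𝒞 α γ β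
𝒞-comm {zero}  (x ∷ [])  (b ∷ [])  (g ∷ [])  = cong (λ s → s - x ∷ []) (+-comm b g)
𝒞-comm {suc n} (x ∷ xs) (b ∷ bs) (g ∷ gs) = begin
  𝒞 (x ∷ xs) (b ∷ bs) (g ∷ gs)                                   ≡⟨ 𝒞-∷ x xs b bs g gs ⟩
  b + g + overflow x (𝒞 xs bs gs) - x ∷ capHead x (𝒞 xs bs gs)
    ≡⟨ cong₂ (λ s δ → s + overflow x δ - x ∷ capHead x δ) (+-comm b g) (𝒞-comm xs bs gs) ⟩
  g + b + overflow x (𝒞 xs gs bs) - x ∷ capHead x (𝒞 xs gs bs)  ≡⟨ 𝒞-∷ x xs g gs b bs ⟨
  𝒞 (x ∷ xs) (g ∷ gs) (b ∷ bs)                                   ∎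
  where open ≡-Reasoning

𝒞-sum : ∀ (α β γ : Vec ℤ (suc n)) → sumℤ (𝒞 α β γ) + sumℤ α ≡ sumℤ β + sumℤ γ
𝒞-sum {zero}  (x ∷ [])  (b ∷ [])  (g ∷ [])  = begin
  b + g - x + 0ℤ + (x + 0ℤ)  ≡⟨ solve (List ℤ ∋ b ∷ g ∷ x ∷ []) ⟩
  b + 0ℤ + (g + 0ℤ)          ∎
  where open ≡-Reasoning
𝒞-sum {suc n} (x ∷ xs) (b ∷ bs) (g ∷ gs) = begin
  sumℤ (𝒞 (x ∷ xs) (b ∷ bs) (g ∷ gs)) + (x + sumℤ xs)
    ≡⟨ cong (λ δ → sumℤ δ + (x + sumℤ xs)) (𝒞-∷ x xs b bs g gs) ⟩
  b + g + overflow x δ - x + sumℤ (capHead x δ) + (x + sumℤ xs)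
    ≡⟨ carry (sumℤ-capHead x δ) (𝒞-sum xs bs gs) ⟩
  b + sumℤ bs + (g + sumℤ gs)
    ∎
  where
  open ≡-Reasoning
  δ = 𝒞 xs bs gs
  carry : ∀ {o c d X B G} → c + o ≡ d → d + X ≡ B + G →
    b + g + o - x + c + (x + X) ≡ b + B + (g + G)
  carry {o} {c} {d} {X} {B} {G} c+o≡d d+X≡B+G = begin
    b + g + o - x + c + (x + X)  ≡⟨ solve (List ℤ ∋ b ∷ g ∷ o ∷ x ∷ c ∷ X ∷ []) ⟩
    b + g + (c + o + X)          ≡⟨ cong (λ s → b + g + (s + X)) c+o≡d ⟩
    b + g + (d + X)              ≡⟨ cong (b + g +_) d+X≡B+G ⟩
    b + g + (B + G)              ≡⟨ solve (List ℤ ∋ b ∷ g ∷ B ∷ G ∷ []) ⟩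
    b + B + (g + G)              ∎

𝒞-size : ∀ (α β γ : Vec ℤ (suc n)) → size β α ≡ size (𝒞 α β γ) γ
𝒞-size α β γ = d+a≡b+c⇒b-a≡d-c {sumℤ α} {sumℤ β} {sumℤ γ} {sumℤ (𝒞 α β γ)} (𝒞-sum α β γ)

𝒞-strip : ∀ (α β γ : Vec ℤ (suc n)) → Strip β α → Strip γ α → Strip (𝒞 α β γ) β
𝒞-strip {zero}  (x ∷ [])  (b ∷ [])  (g ∷ [])  _ (x≤g , _) = k≤k+j-i b x≤g , tt , tt
𝒞-strip {suc n} (x ∷ xs) (b ∷ bs) (g ∷ gs) (x≤b , bs≤x , β/α) (x≤g , _ , γ/α) =
  subst (λ δ → Strip δ (b ∷ bs)) (sym (𝒞-∷ x xs b bs g gs))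
    ( k≤k+j+l-i b x≤g (0≤overflow x δ)
    , Head≤-mono x≤b (Head≤-capHead x δ)
    , capHead-strip bs≤x (𝒞-strip xs bs gs β/α γ/α) )
  where δ = 𝒞 xs bs gs

-- Below the top row the head of the third argument is sᵢ = δᵢ + dᵢ₋₁, so t = αᵢ − dᵢ and e = dᵢ.
𝒞⁻¹ : Vec ℤ (suc n) → Vec ℤ (suc n) → Vec ℤ (suc n) → Vec ℤ (suc n)
𝒞⁻¹ {zero}  (b ∷ [])  (g ∷ [])  (δ ∷ [])  = b + g - δ ∷ []
𝒞⁻¹ {suc n} (b ∷ bs) (g ∷ gs) (δ ∷ δs) =
  let t = b + g - δ
      e = overflow t δs
  in  t + e ∷ 𝒞⁻¹ bs gs (raiseHead e δs)

𝒞⁻¹-𝒞 : ∀ (α β γ : Vec ℤ (suc n)) → 𝒞⁻¹ β γ (𝒞 α β γ) ≡ α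
𝒞⁻¹-𝒞 {zero}  (x ∷ [])  (b ∷ [])  (g ∷ [])  = cong (_∷ []) (i+j-[i+j-k]≡k b g x)
𝒞⁻¹-𝒞 {suc n} (x ∷ xs) (b ∷ bs) (g ∷ gs) = begin
  𝒞⁻¹ (b ∷ bs) (g ∷ gs) (𝒞 (x ∷ xs) (b ∷ bs) (g ∷ gs))
    ≡⟨ cong (𝒞⁻¹ (b ∷ bs) (g ∷ gs)) (𝒞-∷ x xs b bs g gs) ⟩
  𝒞⁻¹ (b ∷ bs) (g ∷ gs) (b + g + o - x ∷ w)
    ≡⟨ cong (λ t → t + overflow t w ∷ 𝒞⁻¹ bs gs (raiseHead (overflow t w) w))
            (i+j-[i+j+k-l]≡l-k b g o x) ⟩
  x - o + overflow (x - o) w ∷ 𝒞⁻¹ bs gs (raiseHead (overflow (x - o) w) w)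
    ≡⟨ cong (λ e → x - o + e ∷ 𝒞⁻¹ bs gs (raiseHead e w)) (overflow-capHead x δ) ⟩
  x - o + o ∷ 𝒞⁻¹ bs gs (raiseHead o w)
    ≡⟨ cong₂ (λ y δ′ → y ∷ 𝒞⁻¹ bs gs δ′) (i-j+j≡i x o) (raiseHead-overflow-capHead x δ) ⟩
  x ∷ 𝒞⁻¹ bs gs δ
    ≡⟨ cong (x ∷_) (𝒞⁻¹-𝒞 xs bs gs) ⟩
  x ∷ xs
    ∎
  where
  open ≡-Reasoning
  δ = 𝒞 xs bs gs
  o = overflow x δ
  w = capHead x δ

𝒞-𝒞⁻¹ : ∀ (β γ δ : Vec ℤ (suc n)) → 𝒞 (𝒞⁻¹ β γ δ) β γ ≡ δ
𝒞-𝒞⁻¹ {zero}  (b ∷ [])  (g ∷ [])  (δ ∷ [])  = cong (_∷ []) (i+j-[i+j-k]≡k b g δ)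
𝒞-𝒞⁻¹ {suc n} (b ∷ bs) (g ∷ gs) (δ ∷ δs) = begin
  𝒞 (t + e ∷ α) (b ∷ bs) (g ∷ gs)
    ≡⟨ 𝒞-∷ (t + e) α b bs g gs ⟩
  b + g + overflow (t + e) (𝒞 α bs gs) - (t + e) ∷ capHead (t + e) (𝒞 α bs gs)
    ≡⟨ cong (λ δ′ → b + g + overflow (t + e) δ′ - (t + e) ∷ capHead (t + e) δ′)
            (𝒞-𝒞⁻¹ bs gs (raiseHead e δs)) ⟩
  b + g + overflow (t + e) (raiseHead e δs) - (t + e) ∷ capHead (t + e) (raiseHead e δs)
    ≡⟨ cong₂ (λ o δ′ → b + g + o - (t + e) ∷ δ′)
             (overflow-raiseHead t e δs) (capHead-raiseHead-overflow t δs) ⟩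
  b + g + e - (t + e) ∷ δs
    ≡⟨ cong (_∷ δs) (i+j+k-[i+j-l+k]≡l b g e δ) ⟩
  δ ∷ δs
    ∎
  where
  open ≡-Reasoning
  t = b + g - δ
  e = overflow t δs
  α = 𝒞⁻¹ bs gs (raiseHead e δs)

𝒞⁻¹-comm : ∀ (β γ δ : Vec ℤ (suc n)) → 𝒞⁻¹ β γ δ ≡ 𝒞⁻¹ γ β δ
𝒞⁻¹-comm β γ δ = begin
  𝒞⁻¹ β γ δ          ≡⟨ 𝒞⁻¹-𝒞 α γ β ⟨
  𝒞⁻¹ γ β (𝒞 α γ β)  ≡⟨ cong (𝒞⁻¹ γ β) (trans (sym (𝒞-comm α β γ)) (𝒞-𝒞⁻¹ β γ δ)) ⟩
  𝒞⁻¹ γ β δ          ∎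
  where
  open ≡-Reasoning
  α = 𝒞⁻¹ β γ δ

𝒞⁻¹-strip : ∀ (β γ δ : Vec ℤ (suc n)) → Strip δ β → Strip δ γ → Strip β (𝒞⁻¹ β γ δ)
𝒞⁻¹-strip {zero}  (b ∷ [])  (g ∷ [])  (δ ∷ [])  _ (g≤δ , _) = k+i-j≤k b g≤δ , tt , tt
𝒞⁻¹-strip {suc n} (b ∷ b′ ∷ bs) (g ∷ g′ ∷ gs) (δ ∷ δ′ ∷ δs)
  (_ , δ′≤b , δs/bs@(b′≤δ′ , _)) (g≤δ , _ , δs/gs) =
    subst (_≤ b) (sym t+e≡δ′⊔t) (⊔-lub δ′≤b (k+i-j≤k b g≤δ)) ,
    subst (b′ ≤_) (sym t+e≡δ′⊔t) (≤-trans b′≤δ′ (i≤i⊔j δ′ t)) ,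
    𝒞⁻¹-strip (b′ ∷ bs) (g′ ∷ gs) (raiseHead e (δ′ ∷ δs))
      (raiseHead-strip (0≤overflow t (δ′ ∷ δs)) δs/bs)
      (raiseHead-strip (0≤overflow t (δ′ ∷ δs)) δs/gs)
  where
  t = b + g - δ
  e = overflow t (δ′ ∷ δs)
  t+e≡δ′⊔t : t + e ≡ δ′ ⊔ t
  t+e≡δ′⊔t = i+[j-i]⊔0≡j⊔i t δ′

𝒞-growthDiagram : ∀ (α β γ : Vec ℤ (suc n)) → HorizontalStrip β α → HorizontalStrip γ α →
  IsShape (𝒞 α β γ) × GrowthDiagram α β γ (𝒞 α β γ)
𝒞-growthDiagram α β γ hsβα hsγα =
  δ-shape ,
  Strip⇒IsShape-inner β/α , Strip⇒IsShape-outer β/α , Strip⇒IsShape-outer γ/α , δ-shape ,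
  hsβα , Strip⇒HorizontalStrip δ/γ , hsγα , Strip⇒HorizontalStrip δ/β ,
  𝒞-size α β γ , trans (𝒞-size α γ β) (cong (λ δ → size δ β) (sym (𝒞-comm α β γ)))
  where
  δ = 𝒞 α β γ
  β/α : Strip β α
  β/α = HorizontalStrip⇒Strip hsβα
  γ/α : Strip γ α
  γ/α = HorizontalStrip⇒Strip hsγα
  δ/β : Strip δ β
  δ/β = 𝒞-strip α β γ β/α γ/α
  δ/γ : Strip δ γ
  δ/γ = subst (λ δ → Strip δ γ) (sym (𝒞-comm α β γ)) (𝒞-strip α γ β γ/α β/α)
  δ-shape : IsShape δ
  δ-shape = Strip⇒IsShape-outer δ/β

𝒞-reversible : ∀ (β γ δ : Vec ℤ (suc n)) → HorizontalStrip δ β → HorizontalStrip δ γ →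
  ∃! _≡_ (λ α → IsShape α × HorizontalStrip β α × HorizontalStrip γ α × 𝒞 α β γ ≡ δ)
𝒞-reversible β γ δ hsδβ hsδγ =
  α , (Strip⇒IsShape-inner β/α , Strip⇒HorizontalStrip β/α , Strip⇒HorizontalStrip γ/α , 𝒞-𝒞⁻¹ β γ δ) ,
  λ (_ , _ , _ , 𝒞α′≡δ) → trans (cong (𝒞⁻¹ β γ) (sym 𝒞α′≡δ)) (𝒞⁻¹-𝒞 _ β γ)
  where
  α = 𝒞⁻¹ β γ δ
  δ/β : Strip δ β
  δ/β = HorizontalStrip⇒Strip hsδβ
  δ/γ : Strip δ γ
  δ/γ = HorizontalStrip⇒Strip hsδγ
  β/α : Strip β α
  β/α = 𝒞⁻¹-strip β γ δ δ/β δ/γ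
  γ/α : Strip γ α
  γ/α = subst (Strip γ) (sym (𝒞⁻¹-comm β γ δ)) (𝒞⁻¹-strip γ β δ δ/γ δ/β)

-- The shape hypotheses are redundant: interlacing forces all four vectors to decrease.
lemma5p2 :
    (∀ (n : ℕ) (α β γ : Vec ℤ (suc n)) →
      IsShape α → IsShape β → IsShape γ →
      HorizontalStrip β α → HorizontalStrip γ α →
      IsShape (𝒞 α β γ) × GrowthDiagram α β γ (𝒞 α β γ))
    ×
    (∀ (n : ℕ) (β γ δ : Vec ℤ (suc n)) →
      IsShape β → IsShape γ → IsShape δ →
      HorizontalStrip δ β → HorizontalStrip δ γ →
      ∃! _≡_ (λ α → IsShape α × HorizontalStrip β α × HorizontalStrip γ α × 𝒞 α β γ ≡ δ))
lemma5p2 =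
  (λ _ α β γ _ _ _ → 𝒞-growthDiagram α β γ) ,
  (λ _ β γ δ _ _ _ → 𝒞-reversible β γ δ)
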